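{- For every $n\ge 3$, any flow-evaluation scheme for the $(2,1)$-group-cut problem, i.e. for the family $\mathcal D=\{K_{A,B}: A,B\subseteq T,\ |A|=2,\ |B|=1\}$, on graphs with $n$ terminals in which $T=V$ and with integer edge weights bounded by a polynomial in $n$, requires storage of $\Omega(n^2\log n)$ bits (for some such graph).
   Context: Graphs $G=(V,E,w)$ are undirected with nonnegative integer edge weights. A partition of $V$ is a collection of pairwise disjoint subsets whose union is $V$; $\Pi(v)$ is the part containing $v$; $\mathrm{cut}_G(\Pi)=\sum_{uv\in E:\,\Pi(u)\ne\Pi(v)}w(uv)$. For a demand graph $D$ (set of vertex pairs), $\Pi$ agrees with $D$ if $\Pi(u)\ne\Pi(v)$ for all $uv\in D$, and $\mathrm{mincut}_G(D)=\min\{\mathrm{cut}_G(\Pi):\Pi\text{ agrees with }D\}$. $K_{A,B}$ (for disjoint $A,B$) is the demand graph of all pairs $ab$, $a\in A,b\in B$. A flow-evaluation scheme is a data structure with a preprocessing operation that, given $G$, terminals $T\subseteq V$ and a family $\mathcal D$ of demand graphs on $T$, constructs a data structure $P(G,T,\mathcal D)$, and a query operation that, given $D\in\mathcal D$, uses only $P(G,T,\mathcal D)$ (without access to $G$) to output $\mathrm{mincut}_G(D)$. Storage is the number of bits of $P(G,T,\mathcal D)$. -}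

module Defs where

open import Data.Nat using (ℕ; zero; suc; _+_; _*_; _^_; _≤_; _<_)
open import Data.Nat.Logarithm using (⌊log₂_⌋)
open import Data.Fin using (Fin; toℕ)
open import Data.Fin.Properties using () renaming (_≟_ to _≟ᶠ_)
open import Data.Nat.Properties using (_<?_)
open import Data.List using (List; map; length)
open import Data.Nat.ListAction using (sum)
open import Data.List.Base using (allFin)
open import Data.Bool using (Bool)
open import Data.Product using (Σ; _×_; ∃)
open import Relation.Nullary using (¬_; yes; no)
open import Relation.Binary.PropositionalEquality using (_≡_)

-- An undirected graph on vertex set V = Fin n with nonnegative integer
-- edge weights, given by a symmetric weight function (weight 0 = no edge).
record Graph (n : ℕ) : Set where
  field
    w    : Fin n → Fin n → ℕ
    symm : ∀ u v → w u v ≡ w v u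
open Graph public

WeightsBounded : ∀ {n} → ℕ → Graph n → Set
WeightsBounded B G = ∀ u v → w G u v ≤ B

-- A partition of V = Fin n is represented by a labelling Π : Fin n → Fin n
-- (parts = fibres; a partition of n elements has at most n parts, so every
-- partition arises).  Π u ≡ Π v  iff  u and v lie in the same part.
Labelling : ℕ → Set
Labelling n = Fin n → Fin n

pairCut : ∀ {n} → Graph n → Labelling n → Fin n → Fin n → ℕ
pairCut G Π u v with toℕ u <? toℕ v
... | no _ = 0
... | yes _ with Π u ≟ᶠ Π v
...   | yes _ = 0
...   | no _  = w G u v

cut : ∀ {n} → Graph n → Labelling n → ℕ
cut {n} G Π = sum (map (λ u → sum (map (λ v → pairCut G Π u v) (allFin n))) (allFin n))

-- A demand K_{A,B} with A = {a₁,a₂} (|A| = 2), B = {b} (|B| = 1), A ∩ B = ∅.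
record Demand21 (n : ℕ) : Set where
  field
    a₁ a₂ b : Fin n
    a₁≢a₂   : ¬ (a₁ ≡ a₂)
    a₁≢b    : ¬ (a₁ ≡ b)
    a₂≢b    : ¬ (a₂ ≡ b)
open Demand21 public

Agrees : ∀ {n} → Labelling n → Demand21 n → Set
Agrees Π D = ¬ (Π (a₁ D) ≡ Π (b D)) × ¬ (Π (a₂ D) ≡ Π (b D))

IsMinCut : ∀ {n} → Graph n → Demand21 n → ℕ → Set
IsMinCut G D m =
  (Σ (Labelling _) λ Π → Agrees Π D × cut G Π ≡ m) ×
  (∀ Π → Agrees Π D → m ≤ cut G Π)

-- A flow-evaluation scheme for the (2,1)-group-cut problem on graphs with
-- n vertices, all of which are terminals (T = V), and weights ≤ B.
-- Data structures are bit strings (List Bool); storage = length.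
record Scheme (n B : ℕ) : Set where
  field
    preprocess : (G : Graph n) → WeightsBounded B G → List Bool
    query      : List Bool → Demand21 n → ℕ
    correct    : ∀ (G : Graph n) (bd : WeightsBounded B G) (D : Demand21 n) →
                 IsMinCut G D (query (preprocess G bd) D)
open Scheme public

-- Fix a hub h and two sides of m ≈ n/2 vertices, put an arbitrary matrix x of weights below n
-- on the edges between the sides, and add hub edges topping every other vertex up to weighted
-- degree H, each hub edge weighing at least K with 2H ≤ 3K.  For the demand ({u, v}, {h}) the
-- hub edges are too heavy for any vertex outside {u, v} to leave h's part profitably, so the
-- min cut is the cut around {u, v}, namely 2H − 2 w(u, v).  Hence every entry of x can be read
-- off from a query, the stored bits determine x, and some of the n ^ (m · m) matrices need at
-- least m · m · ⌊log₂ n⌋ bits.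

module Submission where

open import Defs
open import Data.Bool using (Bool; true; false; if_then_else_; not; _∧_; _∨_; _xor_)
open import Data.Bool.Properties using (∨-zeroʳ) renaming (_≟_ to _≟ᵇ_)
open import Data.Empty using (⊥; ⊥-elim)
open import Data.Fin
  using (Fin; zero; suc; toℕ; fromℕ<; splitAt; combine; finToFun; funToFin; _↑ˡ_; _↑ʳ_)
  renaming (_<_ to _<ᶠ_)
open import Data.Fin.Properties
  using (_≟_; toℕ-injective; toℕ<n; toℕ-fromℕ<; any?; pigeonhole; funToFin-finToFin;
         splitAt-↑ˡ; splitAt-↑ʳ)
  renaming (<⇒≢ to <ᶠ⇒≢)
open import Data.List using (List; []; _∷_; map; length)
open import Data.List.Base using (allFin; tabulate)
import Data.List.Properties as List
import Data.Nat.ListAction as List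
open import Data.Nat
  using (ℕ; zero; suc; pred; ⌊_/2⌋; _+_; _*_; _∸_; _^_; _≤_; _<_; z≤n; s≤s; _≤?_; _<?_; >-nonZero)
open import Data.Nat.Properties hiding (_≟_)
open import Algebra.Properties.Semiring.Sum +-*-semiring
  using (sum; sum-cong-≗; ∑-distrib-+; ∑-comm; sum-replicate-zero; *-distribˡ-sum)
open import Data.Nat.Induction using (<-wellFounded)
open import Data.Nat.Logarithm using (⌊log₂_⌋)
open import Data.Nat.Logarithm.Core using (⌊log2⌋)
open import Data.Nat.Tactic.RingSolver using (solve-∀)
open import Data.Product using (Σ; ∃; ∃₂; _×_; _,_; proj₁; proj₂)
open import Data.Sum using (_⊎_; inj₁; inj₂)
open import Function using (id; _∘_)
open import Induction.WellFounded using (Acc; acc)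
open import Relation.Nullary using (yes; no; does; contradiction; ¬?; _×-dec_)
open import Relation.Nullary.Decidable using (dec-true; dec-false)
open import Relation.Binary.PropositionalEquality

when : Bool → ℕ → ℕ
when b x = if b then x else 0

sum₂ : ∀ {m n} → (Fin m → Fin n → ℕ) → ℕ
sum₂ f = sum (λ a → sum (f a))

sum-const : ∀ n c → sum {n} (λ _ → c) ≡ n * c
sum-const zero    c = refl
sum-const (suc n) c = cong (c +_) (sum-const n c)

sum-mono-≤ : ∀ {n} {f g : Fin n → ℕ} → (∀ i → f i ≤ g i) → sum f ≤ sum g
sum-mono-≤ {zero}  f≤g = z≤n
sum-mono-≤ {suc n} f≤g = +-mono-≤ (f≤g zero) (sum-mono-≤ (f≤g ∘ suc))

≤-sum : ∀ {n} (f : Fin n → ℕ) i → f i ≤ sum f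
≤-sum f zero    = m≤m+n _ _
≤-sum f (suc i) = ≤-trans (≤-sum (f ∘ suc) i) (m≤n+m _ _)

sum₂-+ : ∀ {m n} (f g : Fin m → Fin n → ℕ) →
         sum₂ (λ a b → f a b + g a b) ≡ sum₂ f + sum₂ g
sum₂-+ f g = trans (sum-cong-≗ λ a → ∑-distrib-+ (f a) (g a))
                   (∑-distrib-+ (λ a → sum (f a)) (λ a → sum (g a)))

*-distribˡ-sum₂ : ∀ {m n} c (f : Fin m → Fin n → ℕ) →
                  c * sum₂ f ≡ sum₂ (λ a b → c * f a b)
*-distribˡ-sum₂ c f =
  trans (*-distribˡ-sum c (λ a → sum (f a))) (sum-cong-≗ λ a → *-distribˡ-sum c (f a))

sum₂-mono-≤ : ∀ {m n} {f g : Fin m → Fin n → ℕ} →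
              (∀ a b → f a b ≤ g a b) → sum₂ f ≤ sum₂ g
sum₂-mono-≤ {f = f} {g} f≤g = sum-mono-≤ λ a → sum-mono-≤ {f = f a} {g a} (f≤g a)

sum-when : ∀ {n} b (f : Fin n → ℕ) → sum (λ i → when b (f i)) ≡ when b (sum f)
sum-when true  f = refl
sum-when {n} false f = sum-replicate-zero n

sum-split : ∀ {n} (S : Fin n → Bool) (f : Fin n → ℕ) →
            sum f ≡ sum (λ i → when (S i) (f i)) + sum (λ i → when (not (S i)) (f i))
sum-split S f = trans (sum-cong-≗ λ i → split (S i) (f i))
                      (∑-distrib-+ (λ i → when (S i) (f i)) (λ i → when (not (S i)) (f i)))
  where
  split : ∀ b x → x ≡ when b x + when (not b) x
  split true  x = sym (+-identityʳ x)
  split false x = refl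

sum-when-≟ : ∀ {n} (c : Fin n) (f : Fin n → ℕ) → sum (λ i → when (does (i ≟ c)) (f i)) ≡ f c
sum-when-≟ {suc n} zero    f = trans (cong (f zero +_) (sum-replicate-zero n)) (+-identityʳ _)
sum-when-≟ {suc n} (suc c) f = sum-when-≟ c (f ∘ suc)

inPair : ∀ {n} → Fin n → Fin n → Fin n → Bool
inPair u v a = does (a ≟ u) ∨ does (a ≟ v)

inPair⁻ : ∀ {n} {u v a : Fin n} → inPair u v a ≡ true → a ≡ u ⊎ a ≡ v
inPair⁻ {u = u} {v} {a} a∈ with a ≟ u | a ≟ v
... | yes a≡u | _       = inj₁ a≡u
... | no _    | yes a≡v = inj₂ a≡v

inPair-left : ∀ {n} (u v : Fin n) → inPair u v u ≡ true
inPair-left u v = cong (_∨ does (u ≟ v)) (dec-true (u ≟ u) refl)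

inPair-right : ∀ {n} (u v : Fin n) → inPair u v v ≡ true
inPair-right u v = trans (cong (does (v ≟ u) ∨_) (dec-true (v ≟ v) refl)) (∨-zeroʳ _)

inPair-false : ∀ {n} {u v a : Fin n} → a ≢ u → a ≢ v → inPair u v a ≡ false
inPair-false {u = u} {v} {a} a≢u a≢v = cong₂ _∨_ (dec-false (a ≟ u) a≢u) (dec-false (a ≟ v) a≢v)

sum-when-inPair : ∀ {n} {u v : Fin n} → u ≢ v → ∀ f →
                  sum (λ a → when (inPair u v a) (f a)) ≡ f u + f v
sum-when-inPair {u = u} {v} u≢v f = begin
  sum (λ a → when (inPair u v a) (f a))
    ≡⟨ sum-cong-≗ split ⟩
  sum (λ a → when (does (a ≟ u)) (f a) + when (does (a ≟ v)) (f a))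
    ≡⟨ ∑-distrib-+ (λ a → when (does (a ≟ u)) (f a)) (λ a → when (does (a ≟ v)) (f a)) ⟩
  sum (λ a → when (does (a ≟ u)) (f a)) + sum (λ a → when (does (a ≟ v)) (f a))
    ≡⟨ cong₂ _+_ (sum-when-≟ u f) (sum-when-≟ v f) ⟩
  f u + f v ∎
  where
  open ≡-Reasoning
  split : ∀ a → when (inPair u v a) (f a) ≡ when (does (a ≟ u)) (f a) + when (does (a ≟ v)) (f a)
  split a with a ≟ u | a ≟ v
  ... | yes refl | yes refl = contradiction refl u≢v
  ... | yes _    | no _     = sym (+-identityʳ _)
  ... | no _     | _        = refl

sum-inPair-split : ∀ {n} {u v : Fin n} → u ≢ v → ∀ f →
                   sum f ≡ (f u + f v) + sum (λ a → when (not (inPair u v a)) (f a))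
sum-inPair-split {u = u} {v} u≢v f =
  trans (sum-split (inPair u v) f)
        (cong (_+ sum (λ a → when (not (inPair u v a)) (f a))) (sum-when-inPair u≢v f))

pair-≤-sum : ∀ {n} {c d : Fin n} → c ≢ d → ∀ f → f c + f d ≤ sum f
pair-≤-sum {c = c} {d} c≢d f = begin
  f c + f d                                                ≤⟨ m≤m+n _ _ ⟩
  (f c + f d) + sum (λ a → when (not (inPair c d a)) (f a)) ≡⟨ sum-inPair-split c≢d f ⟨
  sum f                                                    ∎
  where open ≤-Reasoning

when-not-false : ∀ {b} x → b ≡ false → when (not b) x ≡ x
when-not-false x refl = refl

pair+point-≤-sum : ∀ {n} {u v c : Fin n} → u ≢ v → inPair u v c ≡ false → ∀ f →
            (f u + f v) + f c ≤ sum f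
pair+point-≤-sum {u = u} {v} {c} u≢v c∉ f = begin
  (f u + f v) + f c
    ≡⟨ cong ((f u + f v) +_) (when-not-false (f c) c∉) ⟨
  (f u + f v) + outside c
    ≤⟨ +-monoʳ-≤ (f u + f v) (≤-sum outside c) ⟩
  (f u + f v) + sum outside
    ≡⟨ sum-inPair-split u≢v f ⟨
  sum f ∎
  where
  open ≤-Reasoning
  outside = λ a → when (not (inPair u v a)) (f a)

pair+pair-≤-sum : ∀ {n} {u v c d : Fin n} → u ≢ v → c ≢ d →
              inPair u v c ≡ false → inPair u v d ≡ false → ∀ f →
              (f u + f v) + (f c + f d) ≤ sum f
pair+pair-≤-sum {u = u} {v} {c} {d} u≢v c≢d c∉ d∉ f = begin
  (f u + f v) + (f c + f d)
    ≡⟨ cong ((f u + f v) +_) (cong₂ _+_ (when-not-false (f c) c∉) (when-not-false (f d) d∉)) ⟨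
  (f u + f v) + (outside c + outside d)
    ≤⟨ +-monoʳ-≤ (f u + f v) (pair-≤-sum c≢d outside) ⟩
  (f u + f v) + sum outside
    ≡⟨ sum-inPair-split u≢v f ⟨
  sum f ∎
  where
  open ≤-Reasoning
  outside = λ a → when (not (inPair u v a)) (f a)

separated : ∀ {n} → Fin n → Fin n → Bool
separated x y = not (does (x ≟ y))

crossWeight : ∀ {n} → Graph n → Labelling n → Fin n → Fin n → ℕ
crossWeight G Π a b = when (separated (Π a) (Π b)) (w G a b)

crossingSum : ∀ {n} → Graph n → Labelling n → ℕ
crossingSum G Π = sum₂ (crossWeight G Π)

crossWeight-≢ : ∀ {n} (G : Graph n) (Π : Labelling n) {a b} → Π a ≢ Π b →
                crossWeight G Π a b ≡ w G a b
crossWeight-≢ G Π {a} {b} ne = cong (λ s → when (not s) (w G a b)) (dec-false (Π a ≟ Π b) ne)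

pairCut-+-swap : ∀ {n} (G : Graph n) (Π : Labelling n) a b →
                 pairCut G Π a b + pairCut G Π b a ≡ crossWeight G Π a b
pairCut-+-swap G Π a b with toℕ a <? toℕ b | toℕ b <? toℕ a
... | yes a<b | yes b<a = contradiction b<a (<-asym a<b)
... | yes _   | no _ with Π a ≟ Π b
...   | yes _ = refl
...   | no _  = +-identityʳ _
pairCut-+-swap G Π a b | no _ | yes _ with Π b ≟ Π a | Π a ≟ Π b
... | yes _  | yes _  = refl
... | yes eq | no ne  = contradiction (sym eq) ne
... | no ne  | yes eq = contradiction (sym eq) ne
... | no _   | no _   = symm G b a
pairCut-+-swap G Π a b | no a≮b | no b≮a with toℕ-injective (≤-antisym (≮⇒≥ b≮a) (≮⇒≥ a≮b))
... | refl with Π a ≟ Π a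
...   | yes _ = refl
...   | no ne = contradiction refl ne

sum-allFin : ∀ {n} (f : Fin n → ℕ) → List.sum (map f (allFin n)) ≡ sum f
sum-allFin {n} f = trans (cong List.sum (List.map-tabulate id f)) (sum-tabulate f)
  where
  sum-tabulate : ∀ {n} (f : Fin n → ℕ) → List.sum (tabulate f) ≡ sum f
  sum-tabulate {zero}  f = refl
  sum-tabulate {suc n} f = cong (f zero +_) (sum-tabulate (f ∘ suc))

double-cut : ∀ {n} (G : Graph n) (Π : Labelling n) → 2 * cut G Π ≡ crossingSum G Π
double-cut {n} G Π = begin
  2 * cut G Π
    ≡⟨ cong (2 *_) cut≡ ⟩
  2 * C
    ≡⟨ cong (C +_) (+-identityʳ C) ⟩
  C + C
    ≡⟨ cong (C +_) (∑-comm (pairCut G Π)) ⟩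
  C + sum₂ (λ a b → pairCut G Π b a)
    ≡⟨ sum₂-+ (pairCut G Π) (λ a b → pairCut G Π b a) ⟨
  sum₂ (λ a b → pairCut G Π a b + pairCut G Π b a)
    ≡⟨ sum-cong-≗ (λ a → sum-cong-≗ (pairCut-+-swap G Π a)) ⟩
  crossingSum G Π ∎
  where
  open ≡-Reasoning
  C = sum₂ (pairCut G Π)
  cut≡ : cut G Π ≡ C
  cut≡ = trans (cong List.sum (List.map-cong (λ a → sum-allFin (pairCut G Π a)) (allFin n)))
               (sum-allFin (λ a → sum (pairCut G Π a)))

side : ∀ {n} → (Fin n → Bool) → Fin n → Fin n → Labelling n
side S p q a = if S a then p else q

separated-side : ∀ {n} {p q : Fin n} → p ≢ q → ∀ x y →
                 separated (if x then p else q) (if y then p else q) ≡ x xor y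
separated-side {p = p} {q} p≢q true  true  = cong not (dec-true (p ≟ p) refl)
separated-side {p = p} {q} p≢q true  false = cong not (dec-false (p ≟ q) p≢q)
separated-side {p = p} {q} p≢q false true  = cong not (dec-false (q ≟ p) (p≢q ∘ sym))
separated-side {p = p} {q} p≢q false false = cong not (dec-true (q ≟ q) refl)

side-true : ∀ {n} (S : Fin n → Bool) {p q} a → S a ≡ true → side S p q a ≡ p
side-true S {p} {q} a e = cong (λ s → if s then p else q) e

side-false : ∀ {n} (S : Fin n → Bool) {p q} a → S a ≡ false → side S p q a ≡ q
side-false S {p} {q} a e = cong (λ s → if s then p else q) e

crossWeight-side : ∀ {n} (G : Graph n) (S : Fin n → Bool) {p q} → p ≢ q → ∀ a b →
                   crossWeight G (side S p q) a b ≡ when (S a xor S b) (w G a b)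
crossWeight-side G S p≢q a b = cong (λ s → when s (w G a b)) (separated-side p≢q (S a) (S b))

when-xor : ∀ x y z → when (x xor y) z + 2 * when (x ∧ y) z ≡ when x z + when y z
when-xor true  true  z = cong (z +_) (+-identityʳ z)
when-xor true  false z = refl
when-xor false true  z = +-identityʳ z
when-xor false false z = refl

when-∧ : ∀ x y z → when (x ∧ y) z ≡ when x (when y z)
when-∧ true  y z = refl
when-∧ false y z = refl

module _ {n} (G : Graph n) (S : Fin n → Bool) where

  volume : ℕ
  volume = sum (λ a → when (S a) (sum (w G a)))

  innerWeight : ℕ
  innerWeight = sum₂ (λ a b → when (S a ∧ S b) (w G a b))

  -- Doubled form of vol(S) = cut(S, Sᶜ) + 2·w(S, S).
  crossingSum-side : ∀ {p q} → p ≢ q → crossingSum G (side S p q) + 2 * innerWeight ≡ 2 * volume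
  crossingSum-side {p} {q} p≢q = begin
    sum₂ (crossWeight G (side S p q)) + 2 * innerWeight
      ≡⟨ cong₂ _+_ (sum-cong-≗ λ a → sum-cong-≗ (crossWeight-side G S p≢q a))
                   (*-distribˡ-sum₂ 2 (λ a b → when (S a ∧ S b) (w G a b))) ⟩
    sum₂ (λ a b → when (S a xor S b) (w G a b)) + sum₂ (λ a b → 2 * when (S a ∧ S b) (w G a b))
      ≡⟨ sum₂-+ (λ a b → when (S a xor S b) (w G a b)) (λ a b → 2 * when (S a ∧ S b) (w G a b)) ⟨
    sum₂ (λ a b → when (S a xor S b) (w G a b) + 2 * when (S a ∧ S b) (w G a b))
      ≡⟨ sum-cong-≗ (λ a → sum-cong-≗ λ b → when-xor (S a) (S b) (w G a b)) ⟩
    sum₂ (λ a b → when (S a) (w G a b) + when (S b) (w G a b))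
      ≡⟨ sum₂-+ (λ a b → when (S a) (w G a b)) (λ a b → when (S b) (w G a b)) ⟩
    sum₂ (λ a b → when (S a) (w G a b)) + sum₂ (λ a b → when (S b) (w G a b))
      ≡⟨ cong₂ _+_ (sum-cong-≗ λ a → sum-when (S a) (w G a)) transposed ⟩
    volume + volume
      ≡⟨ cong (volume +_) (+-identityʳ volume) ⟨
    2 * volume ∎
    where
    open ≡-Reasoning
    transposed : sum₂ (λ a b → when (S b) (w G a b)) ≡ volume
    transposed = begin
      sum₂ (λ a b → when (S b) (w G a b))  ≡⟨ ∑-comm (λ a b → when (S b) (w G a b)) ⟩
      sum₂ (λ b a → when (S b) (w G a b))  ≡⟨ sum-cong-≗ (λ b → sum-when (S b) (λ a → w G a b)) ⟩
      sum (λ b → when (S b) (sum (λ a → w G a b)))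
        ≡⟨ sum-cong-≗ (λ b → cong (when (S b)) (sum-cong-≗ λ a → symm G a b)) ⟩
      volume ∎

module HubDemand {n} (G : Graph n) (D : Demand21 n) {H K : ℕ}
  (degree₁ : sum (w G (a₁ D)) ≡ H) (degree₂ : sum (w G (a₂ D)) ≡ H)
  (loop₁ : w G (a₁ D) (a₁ D) ≡ 0) (loop₂ : w G (a₂ D) (a₂ D) ≡ 0)
  (heavy : ∀ c → c ≢ b D → K ≤ w G c (b D)) (2H≤3K : 2 * H ≤ 3 * K) where

  private
    u = a₁ D
    v = a₂ D
    h = b D
    U = inPair u v
    Π₀ = side U u h

    h∉U : U h ≡ false
    h∉U = inPair-false (a₁≢b D ∘ sym) (a₂≢b D ∘ sym)

    volume-U : volume G U ≡ H + H
    volume-U = trans (sum-when-inPair (a₁≢a₂ D) (λ a → sum (w G a))) (cong₂ _+_ degree₁ degree₂)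

    innerWeight-U : innerWeight G U ≡ w G u v + w G u v
    innerWeight-U = begin
      sum₂ (λ a b → when (U a ∧ U b) (w G a b))
        ≡⟨ sum-cong-≗ (λ a → sum-cong-≗ λ b → when-∧ (U a) (U b) (w G a b)) ⟩
      sum (λ a → sum (λ b → when (U a) (when (U b) (w G a b))))
        ≡⟨ sum-cong-≗ (λ a → trans (sum-when (U a) (λ b → when (U b) (w G a b)))
                                   (cong (when (U a)) (sum-when-inPair (a₁≢a₂ D) (w G a)))) ⟩
      sum (λ a → when (U a) (w G a u + w G a v))
        ≡⟨ sum-when-inPair (a₁≢a₂ D) (λ a → w G a u + w G a v) ⟩
      (w G u u + w G u v) + (w G v u + w G v v)
        ≡⟨ cong₂ _+_ (cong (_+ w G u v) loop₁) (cong₂ _+_ (symm G v u) loop₂) ⟩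
      w G u v + (w G u v + 0)
        ≡⟨ cong (w G u v +_) (+-identityʳ _) ⟩
      w G u v + w G u v ∎
      where open ≡-Reasoning

    crossingSum-Π₀ : crossingSum G Π₀ + 2 * (w G u v + w G u v) ≡ 2 * (H + H)
    crossingSum-Π₀ = subst₂ (λ i vol → crossingSum G Π₀ + 2 * i ≡ 2 * vol) innerWeight-U volume-U
                            (crossingSum-side G U (a₁≢b D))

    crossingSum-Π₀≤4H : crossingSum G Π₀ ≤ 2 * (H + H)
    crossingSum-Π₀≤4H = ≤-trans (m≤m+n _ _) (≤-reflexive crossingSum-Π₀)

    4H≤6K : 2 * (H + H) ≤ (K + K) + (K + ((K + K) + K))
    4H≤6K = ≤-trans (≤-reflexive (twice H)) (≤-trans (+-mono-≤ 2H≤3K 2H≤3K) (≤-reflexive (six K)))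
      where
      twice : ∀ x → 2 * (x + x) ≡ 2 * x + 2 * x
      twice = solve-∀
      six : ∀ x → 3 * x + 3 * x ≡ (x + x) + (x + ((x + x) + x))
      six = solve-∀

    Π₀-agrees : Agrees Π₀ D
    Π₀-agrees = separate u (inPair-left u v) , separate v (inPair-right u v)
      where
      separate : ∀ a → U a ≡ true → Π₀ a ≢ Π₀ h
      separate a a∈U e = a₁≢b D (trans (sym (side-true U a a∈U)) (trans e (side-false U h h∉U)))

    module _ (Π : Labelling n) (Π-agrees : Agrees Π D) where

      labelled-apart-from-hub : ∀ {a} → U a ≡ true → Π a ≢ Π h
      labelled-apart-from-hub {a} a∈U with inPair⁻ {u = u} {v} {a} a∈U
      ... | inj₁ refl = proj₁ Π-agrees
      ... | inj₂ refl = proj₂ Π-agrees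

      Π₀-below-when-rest-joins-hub : (∀ c → U c ≡ false → Π c ≡ Π h) →
                                     crossingSum G Π₀ ≤ crossingSum G Π
      Π₀-below-when-rest-joins-hub joins = sum₂-mono-≤ λ a b →
        ≤-trans (≤-reflexive (crossWeight-side G U (a₁≢b D) a b)) (pointwise a b)
        where
        pointwise : ∀ a b → when (U a xor U b) (w G a b) ≤ crossWeight G Π a b
        pointwise a b with U a in Ua | U b in Ub
        ... | true  | true  = z≤n
        ... | false | false = z≤n
        ... | true  | false = ≤-reflexive (sym (crossWeight-≢ G Π λ e →
                                labelled-apart-from-hub Ua (trans e (joins b Ub))))
        ... | false | true  = ≤-reflexive (sym (crossWeight-≢ G Π λ e →
                                labelled-apart-from-hub Ub (trans (sym e) (joins a Ua))))

      private
        ≢-hub : ∀ {a} → Π a ≢ Π h → a ≢ h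
        ≢-hub Π-a e = Π-a (cong Π e)

        row : Fin n → ℕ
        row a = sum (crossWeight G Π a)

        row≥K : ∀ {a} → Π a ≢ Π h → K ≤ row a
        row≥K {a} Π-a = ≤-trans (subst (K ≤_) (sym (crossWeight-≢ G Π Π-a)) (heavy a (≢-hub Π-a)))
                                (≤-sum (crossWeight G Π a) h)

        hub-edge≥K : ∀ {a} → Π a ≢ Π h → K ≤ crossWeight G Π h a
        hub-edge≥K {a} Π-a = subst (K ≤_) (sym (trans (crossWeight-≢ G Π (≢-sym Π-a)) (symm G h a)))
                                   (heavy a (≢-hub Π-a))

      6K≤crossingSum : ∀ {c} → U c ≡ false → Π c ≢ Π h →
                       (K + K) + (K + ((K + K) + K)) ≤ crossingSum G Π
      6K≤crossingSum {c} c∉U Π-c = begin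
        (K + K) + (K + ((K + K) + K))
          ≤⟨ +-mono-≤ (+-mono-≤ (row≥K Π-u) (row≥K Π-v)) (+-mono-≤ (row≥K Π-c) 3K≤hub-row) ⟩
        (row u + row v) + (row c + row h)
          ≤⟨ pair+pair-≤-sum (a₁≢a₂ D) (≢-hub Π-c) c∉U h∉U row ⟩
        crossingSum G Π ∎
        where
        open ≤-Reasoning
        Π-u = proj₁ Π-agrees
        Π-v = proj₂ Π-agrees
        3K≤hub-row : (K + K) + K ≤ row h
        3K≤hub-row = ≤-trans
          (+-mono-≤ (+-mono-≤ (hub-edge≥K Π-u) (hub-edge≥K Π-v)) (hub-edge≥K Π-c))
          (pair+point-≤-sum (a₁≢a₂ D) c∉U (crossWeight G Π h))

      Π₀-below : crossingSum G Π₀ ≤ crossingSum G Π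
      Π₀-below with any? (λ c → (U c ≟ᵇ false) ×-dec ¬? (Π c ≟ Π h))
      ... | yes (c , c∉U , Π-c) =
        ≤-trans crossingSum-Π₀≤4H (≤-trans 4H≤6K (6K≤crossingSum c∉U Π-c))
      ... | no no-split = Π₀-below-when-rest-joins-hub joins
        where
        joins : ∀ c → U c ≡ false → Π c ≡ Π h
        joins c c∉U with Π c ≟ Π h
        ... | yes Π-c = Π-c
        ... | no Π-c  = contradiction (c , c∉U , Π-c) no-split

  mincut : ∀ {μ} → IsMinCut G D μ → μ + 2 * w G (a₁ D) (a₂ D) ≡ 2 * H
  mincut {μ} ((Π , Π-agrees , cut≡μ) , μ-minimal) = *-cancelˡ-≡ _ _ 2 (begin
    2 * (μ + 2 * x)                ≡⟨ regroup μ x ⟩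
    2 * μ + 2 * (x + x)            ≡⟨ cong (_+ 2 * (x + x)) 2μ≡ ⟩
    crossingSum G Π₀ + 2 * (x + x) ≡⟨ crossingSum-Π₀ ⟩
    2 * (H + H)                    ≡⟨ cong (2 *_) (cong (H +_) (+-identityʳ H)) ⟨
    2 * (2 * H)                    ∎)
    where
    open ≡-Reasoning
    x = w G u v
    regroup : ∀ a b → 2 * (a + 2 * b) ≡ 2 * a + 2 * (b + b)
    regroup = solve-∀
    2μ≡ : 2 * μ ≡ crossingSum G Π₀
    2μ≡ = ≤-antisym
      (≤-trans (*-monoʳ-≤ 2 (μ-minimal Π₀ Π₀-agrees)) (≤-reflexive (double-cut G Π₀)))
      (≤-trans (Π₀-below Π Π-agrees) (≤-reflexive (trans (sym (double-cut G Π)) (cong (2 *_) cut≡μ))))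

module HubCompletion {n} (w₀ : Fin n → Fin n → ℕ) (w₀-sym : ∀ a b → w₀ a b ≡ w₀ b a)
                         (h : Fin n) {Δ : ℕ} (degree≤ : ∀ a → sum (w₀ a) ≤ Δ) where

  padding : Fin n → Fin n → ℕ
  padding a b = when (does (b ≟ h)) (3 * Δ ∸ sum (w₀ a))

  weight : Fin n → Fin n → ℕ
  weight a b = w₀ a b + (padding a b + padding b a)

  graph : Graph n
  graph = record
    { w = weight
    ; symm = λ a b → cong₂ _+_ (w₀-sym a b) (+-comm (padding a b) (padding b a)) }

  private
    padding-to-hub : ∀ a → padding a h ≡ 3 * Δ ∸ sum (w₀ a)
    padding-to-hub a = cong (λ s → when s (3 * Δ ∸ sum (w₀ a))) (dec-true (h ≟ h) refl)

    padding-off-hub : ∀ {a} b → a ≢ h → padding b a ≡ 0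
    padding-off-hub {a} b a≢h = cong (λ s → when s (3 * Δ ∸ sum (w₀ b))) (dec-false (a ≟ h) a≢h)

  degree : ∀ a → a ≢ h → sum (weight a) ≡ 3 * Δ
  degree a a≢h = begin
    sum (weight a)
      ≡⟨ ∑-distrib-+ (w₀ a) (λ b → padding a b + padding b a) ⟩
    sum (w₀ a) + sum (λ b → padding a b + padding b a)
      ≡⟨ cong (sum (w₀ a) +_) (sum-cong-≗ λ b →
           trans (cong (padding a b +_) (padding-off-hub b a≢h)) (+-identityʳ _)) ⟩
    sum (w₀ a) + sum (padding a)
      ≡⟨ cong (sum (w₀ a) +_) (sum-when-≟ h (λ _ → 3 * Δ ∸ sum (w₀ a))) ⟩
    sum (w₀ a) + (3 * Δ ∸ sum (w₀ a))
      ≡⟨ m+[n∸m]≡n (≤-trans (degree≤ a) (m≤n*m Δ 3)) ⟩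
    3 * Δ ∎
    where open ≡-Reasoning

  heavy : ∀ a → a ≢ h → 2 * Δ ≤ weight a h
  heavy a a≢h = begin
    2 * Δ                     ≡⟨ m+n∸n≡m (2 * Δ) Δ ⟨
    2 * Δ + Δ ∸ Δ             ≡⟨ cong (_∸ Δ) (three Δ) ⟩
    3 * Δ ∸ Δ                 ≤⟨ ∸-monoʳ-≤ (3 * Δ) (degree≤ a) ⟩
    3 * Δ ∸ sum (w₀ a)        ≡⟨ padding-to-hub a ⟨
    padding a h               ≤⟨ m≤m+n _ _ ⟩
    padding a h + padding h a ≤⟨ m≤n+m _ (w₀ a h) ⟩
    weight a h                ∎
    where
    open ≤-Reasoning
    three : ∀ x → 2 * x + x ≡ 3 * x
    three = solve-∀

  off-hub : ∀ {a b} → a ≢ h → b ≢ h → weight a b ≡ w₀ a b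
  off-hub {a} {b} a≢h b≢h =
    trans (cong (w₀ a b +_) (cong₂ _+_ (padding-off-hub a b≢h) (padding-off-hub b a≢h))) (+-identityʳ _)

  bounded : (∀ a b → w₀ a b ≤ Δ) → ∀ a b → weight a b ≤ 7 * Δ
  bounded w₀≤Δ a b = begin
    w₀ a b + (padding a b + padding b a)
      ≤⟨ +-mono-≤ (w₀≤Δ a b) (+-mono-≤ (padding≤ a b) (padding≤ b a)) ⟩
    Δ + (3 * Δ + 3 * Δ)
      ≡⟨ seven Δ ⟩
    7 * Δ ∎
    where
    open ≤-Reasoning
    padding≤ : ∀ a b → padding a b ≤ 3 * Δ
    padding≤ a b with does (b ≟ h)
    ... | true  = m∸n≤m (3 * Δ) (sum (w₀ a))
    ... | false = z≤n
    seven : ∀ x → x + (3 * x + 3 * x) ≡ 7 * x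
    seven = solve-∀

-- A bijective base-2 numeral: the strings of length < L receive distinct codes below 2 ^ L − 1.
code : List Bool → ℕ
code []          = 0
code (false ∷ l) = suc (2 * code l)
code (true ∷ l)  = suc (suc (2 * code l))

code-injective : ∀ l l′ → code l ≡ code l′ → l ≡ l′
code-injective []          []           _  = refl
code-injective []          (false ∷ _)  ()
code-injective []          (true ∷ _)   ()
code-injective (false ∷ _) []           ()
code-injective (true ∷ _)  []           ()
code-injective (false ∷ l) (false ∷ l′) e =
  cong (false ∷_) (code-injective l l′ (*-cancelˡ-≡ _ _ 2 (suc-injective e)))
code-injective (true ∷ l)  (true ∷ l′)  e =
  cong (true ∷_) (code-injective l l′ (*-cancelˡ-≡ _ _ 2 (suc-injective (suc-injective e))))
code-injective (false ∷ l) (true ∷ l′)  e =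
  contradiction (suc-injective e) (even≢odd (code l) (code l′))
code-injective (true ∷ l)  (false ∷ l′) e =
  contradiction (sym (suc-injective e)) (even≢odd (code l′) (code l))

code-bound : ∀ l → 2 + code l ≤ 2 ^ suc (length l)
code-bound []      = ≤-refl
code-bound (b ∷ l) = ≤-trans (step b) (*-monoʳ-≤ 2 (code-bound l))
  where
  double : ∀ c → 4 + 2 * c ≡ 2 * (2 + c)
  double = solve-∀
  step : ∀ b → 2 + code (b ∷ l) ≤ 2 * (2 + code l)
  step false = ≤-trans (n≤1+n _) (≤-reflexive (double (code l)))
  step true  = ≤-reflexive (double (code l))

long-image : ∀ {k} L (f : Fin k → List Bool) → (∀ {i j} → f i ≡ f j → i ≡ j) →
             2 ^ L ≤ k → ∃ λ i → L ≤ length (f i)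
long-image {k} L f f-injective 2^L≤k with any? (λ i → L ≤? length (f i))
... | yes long = long
... | no none   = ⊥-elim (collision (pigeonhole (<-≤-trans pred<2^L 2^L≤k) index))
  where
  instance _ = m^n≢0 2 L
  pred<2^L : pred (2 ^ L) < 2 ^ L
  pred<2^L = m≤pred[n]⇒suc[m]≤n ≤-refl
  code< : ∀ i → code (f i) < pred (2 ^ L)
  code< i = suc[m]≤n⇒m≤pred[n]
    (≤-trans (code-bound (f i)) (^-monoʳ-≤ 2 (≰⇒> λ L≤ → none (i , L≤))))
  index : Fin k → Fin (pred (2 ^ L))
  index i = fromℕ< (code< i)
  collision : (∃₂ λ i j → i <ᶠ j × index i ≡ index j) → ⊥
  collision (i , j , i<j , same) = <ᶠ⇒≢ i<j (f-injective (code-injective (f i) (f j)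
    (trans (sym (toℕ-fromℕ< (code< i))) (trans (cong toℕ same) (toℕ-fromℕ< (code< j))))))

2^⌊log₂⌋≤ : ∀ n → 1 ≤ n → 2 ^ ⌊log₂ n ⌋ ≤ n
2^⌊log₂⌋≤ n = go n (<-wellFounded n)
  where
  halves : ∀ k → 2 * suc ⌊ k /2⌋ ≤ suc (suc k)
  halves k = ≤-trans (≤-reflexive (double ⌊ k /2⌋)) (s≤s (s≤s (≤-trans
               (+-monoʳ-≤ ⌊ k /2⌋ (⌊n/2⌋≤⌈n/2⌉ k)) (≤-reflexive (⌊n/2⌋+⌈n/2⌉≡n k)))))
    where
    double : ∀ h → 2 * suc h ≡ suc (suc (h + h))
    double = solve-∀
  go : ∀ n (acc : Acc _<_ n) → 1 ≤ n → 2 ^ ⌊log2⌋ n acc ≤ n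
  go (suc zero)    _        _ = ≤-refl
  go (suc (suc k)) (acc rs) _ = ≤-trans (*-monoʳ-≤ 2 (go (suc ⌊ k /2⌋) (rs _) (s≤s z≤n))) (halves k)

funToFin-cong : ∀ {m n} {f g : Fin m → Fin n} → f ≗ g → funToFin f ≡ funToFin g
funToFin-cong {zero}  _   = refl
funToFin-cong {suc m} f≗g = cong₂ combine (f≗g zero) (funToFin-cong (f≗g ∘ suc))

finToFun-injective : ∀ {m n} {s t : Fin (m ^ n)} → finToFun {m} {n} s ≗ finToFun t → s ≡ t
finToFun-injective {m} {n} {s} {t} same =
  trans (sym (funToFin-finToFin {n} {m} s)) (trans (funToFin-cong same) (funToFin-finToFin {n} {m} t))

query-sees-only-data : ∀ {n B} (S : Scheme n B) {G G′} bd bd′ →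
                       preprocess S G bd ≡ preprocess S G′ bd′ →
                       ∀ D → IsMinCut G′ D (query S (preprocess S G bd) D)
query-sees-only-data S {G′ = G′} bd bd′ same D =
  subst (λ P → IsMinCut G′ D (query S P D)) (sym same) (correct S G′ bd′ D)

module BipartiteWithHub (m k : ℕ) where

  N : ℕ
  N = m + (m + suc k)

  0<N : 0 < N
  0<N = ≤-trans (s≤s z≤n) (≤-trans (m≤n+m (suc k) m) (m≤n+m (m + suc k) m))

  data Role : Set where
    left right : Fin m → Role
    other      : Role

  role : Fin N → Role
  role a with splitAt m a
  ... | inj₁ i = left i
  ... | inj₂ a′ with splitAt m a′
  ...   | inj₁ j = right j
  ...   | inj₂ _ = other

  leftVertex rightVertex : Fin m → Fin N
  leftVertex i  = i ↑ˡ (m + suc k)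
  rightVertex j = m ↑ʳ (j ↑ˡ suc k)

  hub : Fin N
  hub = m ↑ʳ (m ↑ʳ zero)

  role-left : ∀ i → role (leftVertex i) ≡ left i
  role-left i rewrite splitAt-↑ˡ m i (m + suc k) = refl

  role-right : ∀ j → role (rightVertex j) ≡ right j
  role-right j rewrite splitAt-↑ʳ m (m + suc k) (j ↑ˡ suc k) | splitAt-↑ˡ m j (suc k) = refl

  role-hub : role hub ≡ other
  role-hub rewrite splitAt-↑ʳ m (m + suc k) (m ↑ʳ zero) | splitAt-↑ʳ m (suc k) zero = refl

  role-≢ : ∀ {a b r s} → role a ≡ r → role b ≡ s → r ≢ s → a ≢ b
  role-≢ ra rb r≢s a≡b = r≢s (trans (sym ra) (trans (cong role a≡b) rb))

  demand : Fin m → Fin m → Demand21 N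
  demand i j = record
    { a₁ = leftVertex i ; a₂ = rightVertex j ; b = hub
    ; a₁≢a₂ = role-≢ (role-left i) (role-right j) λ ()
    ; a₁≢b  = role-≢ (role-left i) role-hub λ ()
    ; a₂≢b  = role-≢ (role-right j) role-hub λ () }

  module _ (x : Fin m → Fin m → Fin N) where

    towards : Role → Role → ℕ
    towards (left i) (right j) = toℕ (x i j)
    towards _        _         = 0

    roleWeight : Role → Role → ℕ
    roleWeight r s = towards r s + towards s r

    towards≤N : ∀ r s → towards r s ≤ N
    towards≤N (left i)  (right j) = <⇒≤ (toℕ<n (x i j))
    towards≤N (left i)  (left j)  = z≤n
    towards≤N (left i)  other     = z≤n
    towards≤N (right j) s         = z≤n
    towards≤N other     s         = z≤n

    towards-diag : ∀ r → towards r r ≡ 0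
    towards-diag (left i)  = refl
    towards-diag (right j) = refl
    towards-diag other     = refl

    Δ : ℕ
    Δ = N * (N + N)

    private
      w₀ : Fin N → Fin N → ℕ
      w₀ a b = roleWeight (role a) (role b)

      w₀-sym : ∀ a b → w₀ a b ≡ w₀ b a
      w₀-sym a b = +-comm (towards (role a) (role b)) (towards (role b) (role a))

      w₀-diag : ∀ a → w₀ a a ≡ 0
      w₀-diag a = cong₂ _+_ (towards-diag (role a)) (towards-diag (role a))

      w₀≤ : ∀ a b → w₀ a b ≤ N + N
      w₀≤ a b = +-mono-≤ (towards≤N (role a) (role b)) (towards≤N (role b) (role a))

      w₀≤Δ : ∀ a b → w₀ a b ≤ Δ
      w₀≤Δ a b = ≤-trans (w₀≤ a b) (m≤n*m (N + N) N {{>-nonZero 0<N}})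

      degree≤ : ∀ a → sum (w₀ a) ≤ Δ
      degree≤ a = ≤-trans (sum-mono-≤ (w₀≤ a)) (≤-reflexive (sum-const N (N + N)))

      module Completion = HubCompletion w₀ w₀-sym hub degree≤

    graph : Graph N
    graph = Completion.graph

    weightsBounded : WeightsBounded (14 * N ^ 2) graph
    weightsBounded a b = ≤-trans (Completion.bounded w₀≤Δ a b) (≤-reflexive (scale N))
      where
      scale : ∀ y → 7 * (y * (y + y)) ≡ 14 * (y * (y * 1))
      scale = solve-∀

    mincut-reveals-entry : ∀ i j {μ} → IsMinCut graph (demand i j) μ →
                           μ + 2 * toℕ (x i j) ≡ 2 * (3 * Δ)
    mincut-reveals-entry i j {μ} cut-μ =
      subst (λ e → μ + 2 * e ≡ 2 * (3 * Δ)) entry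
            (HubDemand.mincut graph (demand i j) (degree _ left≢hub) (degree _ right≢hub)
                              (trans (off-hub left≢hub left≢hub) (w₀-diag _))
                              (trans (off-hub right≢hub right≢hub) (w₀-diag _))
                              heavy 6Δ≤6Δ cut-μ)
      where
      open Completion using (weight; degree; heavy; off-hub)
      left≢hub = a₁≢b (demand i j)
      right≢hub = a₂≢b (demand i j)
      entry : weight (leftVertex i) (rightVertex j) ≡ toℕ (x i j)
      entry rewrite off-hub left≢hub right≢hub | role-left i | role-right j = +-identityʳ _
      6Δ≤6Δ : 2 * (3 * Δ) ≤ 3 * (2 * Δ)
      6Δ≤6Δ = ≤-reflexive (swap Δ)
        where swap : ∀ y → 2 * (3 * y) ≡ 3 * (2 * y)
              swap = solve-∀

  matrix : Fin ((N ^ m) ^ m) → Fin m → Fin m → Fin N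
  matrix t i = finToFun (finToFun t i)

  matrix-injective : ∀ {s t} → (∀ i j → matrix s i j ≡ matrix t i j) → s ≡ t
  matrix-injective same = finToFun-injective λ i → finToFun-injective (same i)

  storage-lower-bound : (S : Scheme N (14 * N ^ 2)) →
    Σ (Graph N) λ G → Σ (WeightsBounded (14 * N ^ 2) G) λ bd →
      ⌊log₂ N ⌋ * m * m ≤ length (preprocess S G bd)
  storage-lower-bound S =
    let t , long = long-image (⌊log₂ N ⌋ * m * m) stored stored-injective 2^L≤
    in graph (matrix t) , weightsBounded (matrix t) , long
    where
    stored : Fin ((N ^ m) ^ m) → List Bool
    stored t = preprocess S (graph (matrix t)) (weightsBounded (matrix t))
    stored-injective : ∀ {s t} → stored s ≡ stored t → s ≡ t
    stored-injective {s} {t} same = matrix-injective λ i j →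
      let μ = query S (stored s) (demand i j) in
      toℕ-injective (*-cancelˡ-≡ _ _ 2 (+-cancelˡ-≡ μ _ _ (trans
        (mincut-reveals-entry (matrix s) i j (correct S _ _ (demand i j)))
        (sym (mincut-reveals-entry (matrix t) i j (query-sees-only-data S _ _ same (demand i j)))))))
    2^L≤ : 2 ^ (⌊log₂ N ⌋ * m * m) ≤ (N ^ m) ^ m
    2^L≤ = begin
      2 ^ (⌊log₂ N ⌋ * m * m)         ≡⟨ ^-*-assoc 2 (⌊log₂ N ⌋ * m) m ⟨
      (2 ^ (⌊log₂ N ⌋ * m)) ^ m       ≡⟨ cong (_^ m) (^-*-assoc 2 ⌊log₂ N ⌋ m) ⟨
      ((2 ^ ⌊log₂ N ⌋) ^ m) ^ m       ≤⟨ ^-monoˡ-≤ m (^-monoˡ-≤ m (2^⌊log₂⌋≤ N 0<N)) ⟩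
      (N ^ m) ^ m                     ∎
      where open ≤-Reasoning

halve : ∀ {n} → 6 ≤ n → ∃₂ λ m k → n ≡ m + (m + suc k) × n ≤ 3 * m
halve 6≤n with m≤n⇒∃[o]m+o≡n 6≤n
... | o , refl = go o
  where
  go : ∀ o → ∃₂ λ m k → 6 + o ≡ m + (m + suc k) × 6 + o ≤ 3 * m
  go zero          = 2 , 1 , refl , ≤-refl
  go (suc zero)    = 3 , 0 , refl , m≤m+n 7 2
  go (suc (suc o)) with go o
  ... | m , k , eq , ≤3m =
    suc m , k , trans (cong (2 +_) eq) (shift m k) ,
    ≤-trans (+-mono-≤ (n≤1+n 2) ≤3m) (≤-reflexive (triple m))
    where
    shift : ∀ m k → 2 + (m + (m + suc k)) ≡ suc m + (suc m + suc k)
    shift = solve-∀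
    triple : ∀ m → 3 + 3 * m ≡ 3 * suc m
    triple = solve-∀

square-≤ : ∀ {n m ℓ s} → n ≤ 3 * m → ℓ * m * m ≤ s → 1 * (n * n * ℓ) ≤ 9 * s
square-≤ {n} {m} {ℓ} {s} n≤3m ℓmm≤s = begin
  1 * (n * n * ℓ)         ≡⟨ *-identityˡ _ ⟩
  n * n * ℓ               ≤⟨ *-monoˡ-≤ ℓ (*-mono-≤ n≤3m n≤3m) ⟩
  3 * m * (3 * m) * ℓ     ≡⟨ regroup m ℓ ⟩
  9 * (ℓ * m * m)         ≤⟨ *-monoʳ-≤ 9 ℓmm≤s ⟩
  9 * s                   ∎
  where
  open ≤-Reasoning
  regroup : ∀ m ℓ → 3 * m * (3 * m) * ℓ ≡ 9 * (ℓ * m * m)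
  regroup = solve-∀

theorem5p3 :
    Σ ℕ λ c₀ → Σ ℕ λ k → Σ ℕ λ a → Σ ℕ λ d → Σ ℕ λ n₀ →
      (0 < a) × (0 < d) ×
      (∀ (n : ℕ) → 3 ≤ n → n₀ ≤ n → (S : Scheme n (c₀ * n ^ k)) →
        Σ (Graph n) λ G → Σ (WeightsBounded (c₀ * n ^ k) G) λ bd →
          a * (n * n * ⌊log₂ n ⌋) ≤ d * length (preprocess S G bd))
theorem5p3 = 14 , 2 , 1 , 9 , 6 , s≤s z≤n , s≤s z≤n , lower-bound
  where
  lower-bound : ∀ n → 3 ≤ n → 6 ≤ n → (S : Scheme n (14 * n ^ 2)) →
    Σ (Graph n) λ G → Σ (WeightsBounded (14 * n ^ 2) G) λ bd →
      1 * (n * n * ⌊log₂ n ⌋) ≤ 9 * length (preprocess S G bd)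
  lower-bound n _ 6≤n S with halve 6≤n
  ... | m , k , refl , n≤3m =
    let G , bd , long = BipartiteWithHub.storage-lower-bound m k S
    in G , bd , square-≤ n≤3m long
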